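{- Let $\mathcal{G}\subset 2^{[n]}$ be an IU-family. If there exists a partition $[n]=X\cup Y$ ($X\cap Y=\emptyset$) such that $\mathcal{G}_{\mid X}$ is intersecting and $\mathcal{G}_{\mid Y}$ is union, then $\beta(\mathcal{G})\leq 2^{n-4}$.
   Context: $2^{[n]}$ is the power set of $[n]=\{1,\dots,n\}$. A family $\mathcal{G}\subset 2^{[n]}$ is an IU-family if both $\mathcal{G}$ and $\{[n]\setminus G\colon G\in\mathcal{G}\}$ are intersecting (any two members have nonempty intersection). For $X\subset[n]$, $\mathcal{G}_{\mid X}=\{G\cap X\colon G\in\mathcal{G}\}$. A family $\mathcal{A}$ of subsets of $Y$ is union if $A\cup A'\neq Y$ for all $A,A'\in\mathcal{A}$ (equivalently, the family of complements in $Y$ is intersecting). For distinct $i,j\in[n]$, let $b_{ij}(\mathcal{G})=|\{G\in\mathcal{G}\colon i\in G,\ j\notin G\}|$; the sturdiness is $\beta(\mathcal{G})=\min_{1\leq i\neq j\leq n} b_{ij}(\mathcal{G})$. -}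

module Defs where

open import Data.Bool using (Bool; true; false; _∧_; not; if_then_else_)
open import Data.Nat using (ℕ; zero; suc; _⊓_; _^_)
open import Data.Fin using (Fin; _≟_)
open import Data.Fin.Subset using (Subset; Nonempty; _∩_; _∪_; ∁)
open import Data.Vec using (Vec; []; _∷_; lookup)
open import Data.List using (List; []; _∷_; map; concatMap; filterᵇ; length; foldr; _++_)
open import Data.List.Base using (allFin)
open import Data.Product using (Σ; _×_; _,_)
open import Relation.Binary.PropositionalEquality using (_≡_; _≢_)
open import Relation.Nullary.Decidable using (⌊_⌋)

Family : ℕ → Set
Family n = Subset n → Bool

_∈𝒢_ : ∀ {n} → Subset n → Family n → Set
G ∈𝒢 𝒢 = 𝒢 G ≡ true

Intersecting : ∀ {n} → (Subset n → Set) → Set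
Intersecting {n} P = ∀ (A B : Subset n) → P A → P B → Nonempty (A ∩ B)

⟦_⟧ : ∀ {n} → Family n → Subset n → Set
⟦ 𝒢 ⟧ A = A ∈𝒢 𝒢

Complements : ∀ {n} → Family n → Subset n → Set
Complements {n} 𝒢 A = Σ (Subset n) λ G → G ∈𝒢 𝒢 × ∁ G ≡ A

IU : ∀ {n} → Family n → Set
IU 𝒢 = Intersecting ⟦ 𝒢 ⟧ × Intersecting (Complements 𝒢)

Restrict : ∀ {n} → Family n → Subset n → Subset n → Set
Restrict {n} 𝒢 X A = Σ (Subset n) λ G → G ∈𝒢 𝒢 × G ∩ X ≡ A

UnionOn : ∀ {n} → Subset n → (Subset n → Set) → Set
UnionOn {n} Y P = ∀ (A B : Subset n) → P A → P B → A ∪ B ≢ Y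

allSubsets : ∀ n → List (Subset n)
allSubsets zero = [] ∷ []
allSubsets (suc n) = map (true ∷_) (allSubsets n) ++ map (false ∷_) (allSubsets n)

b : ∀ {n} → Family n → Fin n → Fin n → ℕ
b {n} 𝒢 i j = length (filterᵇ (λ G → 𝒢 G ∧ lookup G i ∧ not (lookup G j)) (allSubsets n))

distinctPairs : ∀ n → List (Fin n × Fin n)
distinctPairs n = concatMap (λ i → concatMap (λ j → if ⌊ i ≟ j ⌋ then [] else ((i , j) ∷ [])) (allFin n)) (allFin n)

-- Sturdiness β(𝒢) = min_{i ≠ j} b_ij(𝒢).  (The start value 2^n is an upper
-- bound for every b_ij and is irrelevant when n ≥ 2, i.e. when the list is nonempty.)
β : ∀ {n} → Family n → ℕ
β {n} 𝒢 = foldr (λ p m → b 𝒢 (Data.Product.proj₁ p) (Data.Product.proj₂ p) ⊓ m) (2 ^ n) (distinctPairs n)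

module Submission where

-- Fix i ≠ j in the same part W of the partition and let V be the other part. The hypotheses on X and
-- Y say exactly that no two members of 𝒢 are complementary on X, resp. on Y. Start from the
-- b_ij + b_ji members of 𝒢 separating i and j. Translating them by V (symmetric difference) gives a
-- disjoint copy, since two members of 𝒢 would otherwise be complementary on V; translating the union
-- by W gives a disjoint copy again, because each set obtained so far still agrees on W with a member
-- of 𝒢 (V is disjoint from W);
-- translating by {i} does so too, as it destroys the separation of i and j. So 8 (b_ij + b_ji) ≤ 2^n.
-- Such i, j exist when n ≥ 3; for n = 2 with X = {x}, Y = {y} every member contains x, so b_yx = 0.

open import Defs
open import Algebra.Bundles using (CommutativeRing)
open import Data.Bool using (Bool; true; false; not; _∧_; _∨_; _xor_; T; T?; if_then_else_)
open import Data.Bool.Properties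
  using (not-involutive; not-¬; ¬-not; ∧-zeroʳ; xor-comm; xor-same; xor-identityʳ; xor-∧-commutativeRing)
open import Data.Fin using (Fin; _≟_)
open import Data.Fin.Patterns using (0F; 1F; 2F)
open import Data.Fin.Subset using (Subset; _∩_; _∪_; ⊥; ⊤; ⁅_⁆)
open import Data.Fin.Subset.Properties using (x∈⁅x⁆; x≢y⇒x∉⁅y⁆; x∈p∩q⁻)
open import Data.List using (List; []; _∷_; map; filterᵇ; length; foldr; _++_; concatMap; allFin)
open import Data.List.Membership.Propositional using (_∈_; lose)
open import Data.List.Membership.Propositional.Properties using (∈-concatMap⁺; ∈-allFin)
open import Data.List.Properties using (length-++; length-map; length-filter; filter-++; filter-none)
open import Data.List.Relation.Unary.All using (universal)
open import Data.List.Relation.Unary.Any using (here; there)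
open import Data.Nat using (ℕ; zero; suc; _+_; _*_; _^_; _⊓_; _≤_; z≤n; s≤s)
open import Data.Nat.Properties
  using (≤-reflexive; ≤-trans; +-comm; +-suc; +-identityʳ; +-mono-≤; *-monoʳ-≤; *-assoc; *-distribˡ-+;
         *-distribʳ-+; m⊓n≤m; m⊓n≤n; n≤0⇒n≡0; module ≤-Reasoning)
open import Data.Product using (Σ; ∃; _×_; _,_; proj₁; proj₂)
open import Data.Sum using (_⊎_; inj₁; inj₂)
open import Data.Vec using (Vec; []; _∷_; lookup; zipWith)
open import Data.Vec.Properties
  using (lookup-zipWith; lookup-replicate; tabulate∘lookup; tabulate-cong; []=⇒lookup; lookup⇒[]=)
open import Function using (_∘_)
open import Relation.Binary.PropositionalEquality
  using (_≡_; _≢_; refl; sym; trans; cong; cong₂; subst; module ≡-Reasoning)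
open import Relation.Nullary using (¬_; yes; no; contradiction)
open import Relation.Nullary.Decidable using (⌊_⌋)
open import Algebra.Properties.CommutativeSemigroup
  (CommutativeRing.+-commutativeSemigroup xor-∧-commutativeRing) using (interchange)

private
  variable
    n : ℕ

count : (Subset n → Bool) → ℕ
count {n} f = length (filterᵇ f (allSubsets n))

length-filterᵇ-map : ∀ {A B : Set} (f : B → Bool) (g : A → B) (xs : List A) →
  length (filterᵇ f (map g xs)) ≡ length (filterᵇ (f ∘ g) xs)
length-filterᵇ-map f g [] = refl
length-filterᵇ-map f g (x ∷ xs) with f (g x)
... | true  = cong suc (length-filterᵇ-map f g xs)
... | false = length-filterᵇ-map f g xs

length-filterᵇ-∨ : ∀ {A : Set} (f g : A → Bool) (xs : List A) → (∀ x → f x ∧ g x ≡ false) →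
  length (filterᵇ (λ x → f x ∨ g x) xs) ≡ length (filterᵇ f xs) + length (filterᵇ g xs)
length-filterᵇ-∨ f g [] disjoint = refl
length-filterᵇ-∨ f g (x ∷ xs) disjoint with f x | g x | disjoint x
... | true  | false | _ = cong suc (length-filterᵇ-∨ f g xs disjoint)
... | false | true  | _ = trans (cong suc (length-filterᵇ-∨ f g xs disjoint)) (sym (+-suc _ _))
... | false | false | _ = length-filterᵇ-∨ f g xs disjoint

length-allSubsets : ∀ n → length (allSubsets n) ≡ 2 ^ n
length-allSubsets zero = refl
length-allSubsets (suc n) = begin
    length (map (true ∷_) 𝒮 ++ map (false ∷_) 𝒮)
  ≡⟨ length-++ (map (true ∷_) 𝒮) ⟩
    length (map (true ∷_) 𝒮) + length (map (false ∷_) 𝒮)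
  ≡⟨ cong₂ _+_ (length-map (true ∷_) 𝒮) (length-map (false ∷_) 𝒮) ⟩
    length 𝒮 + length 𝒮
  ≡⟨ cong (λ m → m + m) (length-allSubsets n) ⟩
    2 ^ n + 2 ^ n
  ≡⟨ cong (2 ^ n +_) (sym (+-identityʳ (2 ^ n))) ⟩
    2 ^ suc n
  ∎
  where
  open ≡-Reasoning
  𝒮 = allSubsets n

count-≤ : (f : Subset n → Bool) → count f ≤ 2 ^ n
count-≤ {n} f = ≤-trans (length-filter (T? ∘ f) (allSubsets n)) (≤-reflexive (length-allSubsets n))

count-none : (f : Subset n → Bool) → (∀ S → f S ≡ false) → count f ≡ 0
count-none {n} f none =
  cong length (filter-none (T? ∘ f) (universal (λ S → subst T (none S)) (allSubsets n)))

count-∨ : (f g : Subset n → Bool) → (∀ S → f S ∧ g S ≡ false) →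
  count (λ S → f S ∨ g S) ≡ count f + count g
count-∨ {n} f g = length-filterᵇ-∨ f g (allSubsets n)

count-∷ : (f : Subset (suc n) → Bool) → count f ≡ count (f ∘ (true ∷_)) + count (f ∘ (false ∷_))
count-∷ {n} f = begin
    length (filterᵇ f (map (true ∷_) 𝒮 ++ map (false ∷_) 𝒮))
  ≡⟨ cong length (filter-++ (T? ∘ f) (map (true ∷_) 𝒮) (map (false ∷_) 𝒮)) ⟩
    length (filterᵇ f (map (true ∷_) 𝒮) ++ filterᵇ f (map (false ∷_) 𝒮))
  ≡⟨ length-++ (filterᵇ f (map (true ∷_) 𝒮)) ⟩
    length (filterᵇ f (map (true ∷_) 𝒮)) + length (filterᵇ f (map (false ∷_) 𝒮))
  ≡⟨ cong₂ _+_ (length-filterᵇ-map f (true ∷_) 𝒮) (length-filterᵇ-map f (false ∷_) 𝒮) ⟩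
    count (f ∘ (true ∷_)) + count (f ∘ (false ∷_))
  ∎
  where
  open ≡-Reasoning
  𝒮 = allSubsets n

infixl 6 _⊕_

_⊕_ : Subset n → Subset n → Subset n
_⊕_ = zipWith _xor_

count-⊕ : (f : Subset n → Bool) (M : Subset n) → count (λ S → f (S ⊕ M)) ≡ count f
count-⊕ f [] with f []
... | true  = refl
... | false = refl
count-⊕ f (m ∷ M) = begin
    count (λ S → f (S ⊕ (m ∷ M)))
  ≡⟨ count-∷ (λ S → f (S ⊕ (m ∷ M))) ⟩
    count (λ S → f (not m ∷ S ⊕ M)) + count (λ S → f (m ∷ S ⊕ M))
  ≡⟨ cong₂ _+_ (count-⊕ (f ∘ (not m ∷_)) M) (count-⊕ (f ∘ (m ∷_)) M) ⟩
    count (f ∘ (not m ∷_)) + count (f ∘ (m ∷_))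
  ≡⟨ recombine m ⟩
    count f
  ∎
  where
  open ≡-Reasoning
  recombine : ∀ m → count (f ∘ (not m ∷_)) + count (f ∘ (m ∷_)) ≡ count f
  recombine true  = trans (+-comm (count (f ∘ (false ∷_))) (count (f ∘ (true ∷_)))) (sym (count-∷ f))
  recombine false = sym (count-∷ f)

double : (Subset n → Bool) → Subset n → Subset n → Bool
double f M S = f S ∨ f (S ⊕ M)

count-double : ∀ {P : Subset n → Set} (f : Subset n → Bool) (M : Subset n) →
  (∀ S → f S ≡ true → P S) → (∀ S → P S → ¬ P (S ⊕ M)) →
  count (double f M) ≡ 2 * count f
count-double f M f⊆P apart = begin
    count (double f M)
  ≡⟨ count-∨ f (λ S → f (S ⊕ M)) disjoint ⟩
    count f + count (λ S → f (S ⊕ M))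
  ≡⟨ cong (count f +_) (count-⊕ f M) ⟩
    count f + count f
  ≡⟨ cong (count f +_) (sym (+-identityʳ (count f))) ⟩
    2 * count f
  ∎
  where
  open ≡-Reasoning
  disjoint : ∀ S → f S ∧ f (S ⊕ M) ≡ false
  disjoint S with f S in fS | f (S ⊕ M) in fS⊕M
  ... | true  | true  = contradiction (f⊆P (S ⊕ M) fS⊕M) (apart S (f⊆P S fS))
  ... | true  | false = refl
  ... | false | _     = refl

double-⊆ : ∀ {P : Subset n → Set} (f : Subset n → Bool) (M : Subset n) →
  (∀ S → P (S ⊕ M) → P S) → (∀ S → f S ≡ true → P S) →
  ∀ S → double f M S ≡ true → P S
double-⊆ f M back f⊆P S h with f S in fS
... | true  = f⊆P S fS
... | false = back S (f⊆P (S ⊕ M) h)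

lookup-⊕ : (S M : Subset n) (k : Fin n) → lookup (S ⊕ M) k ≡ lookup S k xor lookup M k
lookup-⊕ S M k = lookup-zipWith _xor_ k S M

lookup-⊕-∈ : (S M : Subset n) (k : Fin n) → lookup M k ≡ true → lookup (S ⊕ M) k ≡ not (lookup S k)
lookup-⊕-∈ S M k k∈M =
  trans (lookup-⊕ S M k) (trans (cong (lookup S k xor_) k∈M) (xor-comm (lookup S k) true))

lookup-⊕-∉ : (S M : Subset n) (k : Fin n) → lookup M k ≡ false → lookup (S ⊕ M) k ≡ lookup S k
lookup-⊕-∉ S M k k∉M =
  trans (lookup-⊕ S M k) (trans (cong (lookup S k xor_) k∉M) (xor-identityʳ (lookup S k)))

Separates : Fin n → Fin n → Subset n → Set
Separates i j S = lookup S i xor lookup S j ≡ true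

separation-⊕ : (i j : Fin n) (S M : Subset n) →
  lookup (S ⊕ M) i xor lookup (S ⊕ M) j ≡ (lookup S i xor lookup S j) xor (lookup M i xor lookup M j)
separation-⊕ i j S M = trans (cong₂ _xor_ (lookup-⊕ S M i) (lookup-⊕ S M j))
  (interchange (lookup S i) (lookup M i) (lookup S j) (lookup M j))

separates-⊕-balanced : ∀ {i j : Fin n} {M} S → lookup M i ≡ lookup M j →
  Separates i j (S ⊕ M) → Separates i j S
separates-⊕-balanced {i = i} {j} {M} S Mi≡Mj sep = begin
    lookup S i xor lookup S j
  ≡⟨ sym (xor-identityʳ _) ⟩
    (lookup S i xor lookup S j) xor false
  ≡⟨ cong ((lookup S i xor lookup S j) xor_) (sym balanced) ⟩
    (lookup S i xor lookup S j) xor (lookup M i xor lookup M j)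
  ≡⟨ sym (separation-⊕ i j S M) ⟩
    lookup (S ⊕ M) i xor lookup (S ⊕ M) j
  ≡⟨ sep ⟩
    true
  ∎
  where
  open ≡-Reasoning
  balanced : lookup M i xor lookup M j ≡ false
  balanced = trans (cong (_xor lookup M j) Mi≡Mj) (xor-same (lookup M j))

separates-⊕-separating : ∀ {i j : Fin n} {M} S → Separates i j M →
  Separates i j S → ¬ Separates i j (S ⊕ M)
separates-⊕-separating {i = i} {j} {M} S sepM sepS sepS⊕M =
  contradiction (trans (sym sepS⊕M) (trans (separation-⊕ i j S M) (cong₂ _xor_ sepS sepM))) λ ()

separates-⁅⁆ : {i j : Fin n} → i ≢ j → Separates i j ⁅ i ⁆
separates-⁅⁆ {i = i} {j} i≢j =
  cong₂ _xor_ ([]=⇒lookup (x∈⁅x⁆ i)) (¬-not (x≢y⇒x∉⁅y⁆ (i≢j ∘ sym) ∘ lookup⇒[]= j ⁅ i ⁆))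

Disjoint : Subset n → Subset n → Set
Disjoint M D = ∀ k → lookup M k ≡ true → lookup D k ≡ false

AgreeOn : Subset n → Subset n → Subset n → Set
AgreeOn M S T = ∀ k → lookup M k ≡ true → lookup S k ≡ lookup T k

OppositeOn : Subset n → Subset n → Subset n → Set
OppositeOn M S T = ∀ k → lookup M k ≡ true → lookup T k ≡ not (lookup S k)

NoOppositePairOn : Subset n → Family n → Set
NoOppositePairOn M 𝒢 = ∀ {S T} → S ∈𝒢 𝒢 → T ∈𝒢 𝒢 → ¬ OppositeOn M S T

NearOn : Subset n → Family n → Subset n → Set
NearOn {n} M 𝒢 S = Σ (Subset n) λ T → T ∈𝒢 𝒢 × AgreeOn M S T

member⇒nearOn : ∀ {M} {𝒢 : Family n} {S} → S ∈𝒢 𝒢 → NearOn M 𝒢 S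
member⇒nearOn {S = S} S∈𝒢 = S , S∈𝒢 , λ _ _ → refl

nearOn-⊕-disjoint : ∀ {M D} {𝒢 : Family n} S → Disjoint M D → NearOn M 𝒢 (S ⊕ D) → NearOn M 𝒢 S
nearOn-⊕-disjoint {D = D} S disjoint (T , T∈𝒢 , agree) =
  T , T∈𝒢 , λ k k∈M → trans (sym (lookup-⊕-∉ S D k (disjoint k k∈M))) (agree k k∈M)

nearOn-⊕-self : ∀ {M} {𝒢 : Family n} S → NoOppositePairOn M 𝒢 →
  NearOn M 𝒢 S → ¬ NearOn M 𝒢 (S ⊕ M)
nearOn-⊕-self {M = M} S noPair (T , T∈𝒢 , agree) (T′ , T′∈𝒢 , agree′) =
  noPair T∈𝒢 T′∈𝒢 opposite
  where
  opposite : OppositeOn M T T′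
  opposite k k∈M = trans (sym (agree′ k k∈M)) (trans (lookup-⊕-∈ S M k k∈M) (cong not (agree k k∈M)))

restriction-meets : ∀ {𝒢 : Family n} {X} → Intersecting (Restrict 𝒢 X) →
  ∀ {S T} → S ∈𝒢 𝒢 → T ∈𝒢 𝒢 → ∃ λ k → lookup S k ≡ true × lookup X k ≡ true × lookup T k ≡ true
restriction-meets {X = X} intersecting {S} {T} S∈𝒢 T∈𝒢
  with intersecting (S ∩ X) (T ∩ X) (S , S∈𝒢 , refl) (T , T∈𝒢 , refl)
... | k , k∈ with x∈p∩q⁻ (S ∩ X) (T ∩ X) k∈
...   | k∈S∩X , k∈T∩X with x∈p∩q⁻ S X k∈S∩X | x∈p∩q⁻ T X k∈T∩X
...     | k∈S , k∈X | k∈T , _ = k , []=⇒lookup k∈S , []=⇒lookup k∈X , []=⇒lookup k∈T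

intersecting⇒noOppositePair : ∀ {𝒢 : Family n} {X} → Intersecting (Restrict 𝒢 X) → NoOppositePairOn X 𝒢
intersecting⇒noOppositePair intersecting S∈𝒢 T∈𝒢 opposite
  with restriction-meets intersecting S∈𝒢 T∈𝒢
... | k , k∈S , k∈X , k∈T = not-¬ (trans k∈T (sym k∈S)) (opposite k k∈X)

vec-ext : ∀ {A : Set} {u v : Vec A n} → (∀ k → lookup u k ≡ lookup v k) → u ≡ v
vec-ext {u = u} {v} eq = trans (sym (tabulate∘lookup u)) (trans (tabulate-cong eq) (tabulate∘lookup v))

union⇒noOppositePair : ∀ {𝒢 : Family n} {Y} → UnionOn Y (Restrict 𝒢 Y) → NoOppositePairOn Y 𝒢
union⇒noOppositePair {Y = Y} union {S} {T} S∈𝒢 T∈𝒢 opposite =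
  union (S ∩ Y) (T ∩ Y) (S , S∈𝒢 , refl) (T , T∈𝒢 , refl) (vec-ext covers)
  where
  cover : ∀ s t y → (y ≡ true → t ≡ not s) → (s ∧ y) ∨ (t ∧ y) ≡ y
  cover true  t     true  _   = refl
  cover false t     true  opp = cong (_∧ true) (opp refl)
  cover s     t     false _   = cong₂ _∨_ (∧-zeroʳ s) (∧-zeroʳ t)
  covers : ∀ k → lookup (S ∩ Y ∪ T ∩ Y) k ≡ lookup Y k
  covers k = begin
      lookup (S ∩ Y ∪ T ∩ Y) k
    ≡⟨ lookup-zipWith _∨_ k (S ∩ Y) (T ∩ Y) ⟩
      lookup (S ∩ Y) k ∨ lookup (T ∩ Y) k
    ≡⟨ cong₂ _∨_ (lookup-zipWith _∧_ k S Y) (lookup-zipWith _∧_ k T Y) ⟩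
      (lookup S k ∧ lookup Y k) ∨ (lookup T k ∧ lookup Y k)
    ≡⟨ cover (lookup S k) (lookup T k) (lookup Y k) (opposite k) ⟩
      lookup Y k
    ∎
    where open ≡-Reasoning

separating : Family n → Fin n → Fin n → Subset n → Bool
separating 𝒢 i j G =
  (𝒢 G ∧ lookup G i ∧ not (lookup G j)) ∨ (𝒢 G ∧ lookup G j ∧ not (lookup G i))

count-separating : (𝒢 : Family n) (i j : Fin n) → count (separating 𝒢 i j) ≡ b 𝒢 i j + b 𝒢 j i
count-separating 𝒢 i j = count-∨ _ _ disjoint
  where
  disjoint : ∀ G →
    (𝒢 G ∧ lookup G i ∧ not (lookup G j)) ∧ (𝒢 G ∧ lookup G j ∧ not (lookup G i)) ≡ false
  disjoint G with 𝒢 G | lookup G i | lookup G j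
  ... | false | _     | _     = refl
  ... | true  | false | _     = refl
  ... | true  | true  | false = refl
  ... | true  | true  | true  = refl

separating-member : (𝒢 : Family n) (i j : Fin n) (S : Subset n) →
  separating 𝒢 i j S ≡ true → S ∈𝒢 𝒢 × Separates i j S
separating-member 𝒢 i j S sep with 𝒢 S | lookup S i | lookup S j
... | true  | true  | false = refl , refl
... | true  | false | true  = refl , refl
... | true  | true  | true  = contradiction sep λ ()
... | true  | false | false = contradiction sep λ ()
... | false | _     | _     = contradiction sep λ ()

separating-count-bound : (𝒢 : Family n) {W V : Subset n} {i j : Fin n} →
  NoOppositePairOn W 𝒢 → NoOppositePairOn V 𝒢 → Disjoint W V →
  i ≢ j → lookup W i ≡ true → lookup W j ≡ true →
  8 * count (separating 𝒢 i j) ≤ 2 ^ n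
separating-count-bound {n} 𝒢 {W} {V} {i} {j} noPairW noPairV W∩V≡∅ i≢j i∈W j∈W = begin
    8 * count Q
  ≡⟨ eightfold ⟩
    count G₃
  ≤⟨ count-≤ G₃ ⟩
    2 ^ n
  ∎
  where
  open ≤-Reasoning
  Q G₁ G₂ G₃ : Subset n → Bool
  Q  = separating 𝒢 i j
  G₁ = double Q V
  G₂ = double G₁ W
  G₃ = double G₂ ⁅ i ⁆

  Q⊆nearOn : ∀ {M} S → Q S ≡ true → NearOn M 𝒢 S
  Q⊆nearOn {M} S h = member⇒nearOn {M = M} {𝒢 = 𝒢} (proj₁ (separating-member 𝒢 i j S h))

  G₁⊆nearOnW : ∀ S → G₁ S ≡ true → NearOn W 𝒢 S
  G₁⊆nearOnW =
    double-⊆ Q V (λ S → nearOn-⊕-disjoint {M = W} {D = V} {𝒢 = 𝒢} S W∩V≡∅) (Q⊆nearOn {W})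

  G₁⊆separates : ∀ S → G₁ S ≡ true → Separates i j S
  G₁⊆separates = double-⊆ Q V
    (λ S → separates-⊕-balanced S (trans (W∩V≡∅ i i∈W) (sym (W∩V≡∅ j j∈W))))
    (λ S → proj₂ ∘ separating-member 𝒢 i j S)

  G₂⊆separates : ∀ S → G₂ S ≡ true → Separates i j S
  G₂⊆separates = double-⊆ G₁ W (λ S → separates-⊕-balanced S (trans i∈W (sym j∈W))) G₁⊆separates

  count-G₁ : count G₁ ≡ 2 * count Q
  count-G₁ = count-double Q V (Q⊆nearOn {V}) (λ S → nearOn-⊕-self {M = V} {𝒢 = 𝒢} S noPairV)

  count-G₂ : count G₂ ≡ 2 * count G₁
  count-G₂ = count-double G₁ W G₁⊆nearOnW (λ S → nearOn-⊕-self {M = W} {𝒢 = 𝒢} S noPairW)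

  count-G₃ : count G₃ ≡ 2 * count G₂
  count-G₃ = count-double G₂ ⁅ i ⁆ G₂⊆separates (λ S → separates-⊕-separating S (separates-⁅⁆ i≢j))

  eightfold : 8 * count Q ≡ count G₃
  eightfold = begin-equality
      8 * count Q
    ≡⟨ *-assoc 2 4 (count Q) ⟩
      2 * (4 * count Q)
    ≡⟨ cong (2 *_) (*-assoc 2 2 (count Q)) ⟩
      2 * (2 * (2 * count Q))
    ≡⟨ cong (λ c → 2 * (2 * c)) (sym count-G₁) ⟩
      2 * (2 * count G₁)
    ≡⟨ cong (2 *_) (sym count-G₂) ⟩
      2 * count G₂
    ≡⟨ sym count-G₃ ⟩
      count G₃
    ∎

foldr-⊓-≤ : ∀ {A : Set} (h : A → ℕ) (z : ℕ) {xs : List A} {x : A} → x ∈ xs →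
  foldr (λ y m → h y ⊓ m) z xs ≤ h x
foldr-⊓-≤ h z {y ∷ _} (here refl) = m⊓n≤m (h y) _
foldr-⊓-≤ h z {y ∷ _} (there x∈xs) = ≤-trans (m⊓n≤n (h y) _) (foldr-⊓-≤ h z x∈xs)

∈-distinctPairs : ∀ {i j : Fin n} → i ≢ j → (i , j) ∈ distinctPairs n
∈-distinctPairs {n} {i} {j} i≢j =
  ∈-concatMap⁺ row (lose (∈-allFin i) (∈-concatMap⁺ (entry i) (lose (∈-allFin j) singleton)))
  where
  entry : Fin n → Fin n → List (Fin n × Fin n)
  entry i′ j′ = if ⌊ i′ ≟ j′ ⌋ then [] else ((i′ , j′) ∷ [])
  row : Fin n → List (Fin n × Fin n)
  row i′ = concatMap (entry i′) (allFin n)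
  singleton : (i , j) ∈ entry i j
  singleton with i ≟ j
  ... | yes i≡j = contradiction i≡j i≢j
  ... | no  _   = here refl

β≤b : (𝒢 : Family n) {i j : Fin n} → i ≢ j → β 𝒢 ≤ b 𝒢 i j
β≤b {n} 𝒢 i≢j = foldr-⊓-≤ (λ p → b 𝒢 (proj₁ p) (proj₂ p)) (2 ^ n) (∈-distinctPairs i≢j)

separating-bound⇒β-bound : (𝒢 : Family n) {i j : Fin n} → i ≢ j →
  8 * count (separating 𝒢 i j) ≤ 2 ^ n → 16 * β 𝒢 ≤ 2 ^ n
separating-bound⇒β-bound {n} 𝒢 {i} {j} i≢j bound = begin
    16 * β 𝒢
  ≡⟨ *-distribʳ-+ (β 𝒢) 8 8 ⟩
    8 * β 𝒢 + 8 * β 𝒢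
  ≤⟨ +-mono-≤ (*-monoʳ-≤ 8 (β≤b 𝒢 i≢j)) (*-monoʳ-≤ 8 (β≤b 𝒢 (i≢j ∘ sym))) ⟩
    8 * b 𝒢 i j + 8 * b 𝒢 j i
  ≡⟨ sym (*-distribˡ-+ 8 (b 𝒢 i j) (b 𝒢 j i)) ⟩
    8 * (b 𝒢 i j + b 𝒢 j i)
  ≡⟨ cong (8 *_) (sym (count-separating 𝒢 i j)) ⟩
    8 * count (separating 𝒢 i j)
  ≤⟨ bound ⟩
    2 ^ n
  ∎
  where open ≤-Reasoning

common-element⇒β≡0 : (𝒢 : Family n) {x y : Fin n} →
  (∀ G → G ∈𝒢 𝒢 → lookup G x ≡ true) → y ≢ x → β 𝒢 ≡ 0
common-element⇒β≡0 𝒢 {x} {y} common y≢x =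
  n≤0⇒n≡0 (≤-trans (β≤b 𝒢 y≢x) (≤-reflexive (count-none _ absent)))
  where
  absent : ∀ G → 𝒢 G ∧ lookup G y ∧ not (lookup G x) ≡ false
  absent G with 𝒢 G in G∈𝒢
  ... | false = refl
  ... | true  rewrite common G G∈𝒢 = ∧-zeroʳ (lookup G y)

Complementary : Subset n → Subset n → Set
Complementary X Y = ∀ k → lookup Y k ≡ not (lookup X k)

partition⇒complementary : ∀ {X Y : Subset n} → X ∩ Y ≡ ⊥ → X ∪ Y ≡ ⊤ → Complementary X Y
partition⇒complementary {X = X} {Y} X∩Y≡⊥ X∪Y≡⊤ k = complementary (lookup X k) (lookup Y k) meet join
  where
  meet : lookup X k ∧ lookup Y k ≡ false
  meet = trans (sym (lookup-zipWith _∧_ k X Y))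
    (trans (cong (λ Z → lookup Z k) X∩Y≡⊥) (lookup-replicate k false))
  join : lookup X k ∨ lookup Y k ≡ true
  join = trans (sym (lookup-zipWith _∨_ k X Y))
    (trans (cong (λ Z → lookup Z k) X∪Y≡⊤) (lookup-replicate k true))
  complementary : ∀ x y → x ∧ y ≡ false → x ∨ y ≡ true → y ≡ not x
  complementary true  y x∧y≡false _ = x∧y≡false
  complementary false y _ x∨y≡true = x∨y≡true

complementary⇒disjoint : ∀ {X Y : Subset n} → Complementary X Y → Disjoint X Y
complementary⇒disjoint Y≡∁X k k∈X = trans (Y≡∁X k) (cong not k∈X)

complementary-sym : ∀ {X Y : Subset n} → Complementary X Y → Complementary Y X
complementary-sym Y≡∁X k = trans (sym (not-involutive _)) (cong not (sym (Y≡∁X k)))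

same-part-bound : (𝒢 : Family n) {X Y : Subset n} →
  Intersecting (Restrict 𝒢 X) → UnionOn Y (Restrict 𝒢 Y) → Complementary X Y →
  {i j : Fin n} → i ≢ j → lookup X i ≡ lookup X j → 16 * β 𝒢 ≤ 2 ^ n
same-part-bound 𝒢 {X} {Y} intersecting union Y≡∁X {i} {j} i≢j Xi≡Xj with lookup X i in i∈X
... | true  = separating-bound⇒β-bound 𝒢 i≢j (separating-count-bound 𝒢 {X} {Y}
  (intersecting⇒noOppositePair intersecting) (union⇒noOppositePair union)
  (complementary⇒disjoint {X = X} {Y} Y≡∁X) i≢j i∈X (sym Xi≡Xj))
... | false = separating-bound⇒β-bound 𝒢 i≢j (separating-count-bound 𝒢 {Y} {X}
  (union⇒noOppositePair union) (intersecting⇒noOppositePair intersecting)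
  (complementary⇒disjoint {X = Y} {X} (complementary-sym {X = X} {Y} Y≡∁X)) i≢j
  (trans (Y≡∁X i) (cong not i∈X)) (trans (Y≡∁X j) (cong not (sym Xi≡Xj))))

singleton-part⇒β≡0 : (𝒢 : Family n) {X : Subset n} → Intersecting (Restrict 𝒢 X) →
  {x y : Fin n} → (∀ k → lookup X k ≡ true → k ≡ x) → y ≢ x → β 𝒢 ≡ 0
singleton-part⇒β≡0 𝒢 intersecting {x} X⊆⁅x⁆ = common-element⇒β≡0 𝒢 contains-x
  where
  contains-x : ∀ G → G ∈𝒢 𝒢 → lookup G x ≡ true
  contains-x G G∈𝒢 with restriction-meets intersecting G∈𝒢 G∈𝒢
  ... | k , k∈G , k∈X , _ = subst (λ k → lookup G k ≡ true) (X⊆⁅x⁆ k k∈X) k∈G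

bool-pigeonhole : ∀ (a b c : Bool) → a ≡ b ⊎ a ≡ c ⊎ b ≡ c
bool-pigeonhole false false _     = inj₁ refl
bool-pigeonhole true  true  _     = inj₁ refl
bool-pigeonhole false true  false = inj₂ (inj₁ refl)
bool-pigeonhole true  false true  = inj₂ (inj₁ refl)
bool-pigeonhole false true  true  = inj₂ (inj₂ refl)
bool-pigeonhole true  false false = inj₂ (inj₂ refl)

partition-bound : ∀ n → 2 ≤ n → (𝒢 : Family n) {X Y : Subset n} →
  Intersecting (Restrict 𝒢 X) → UnionOn Y (Restrict 𝒢 Y) → Complementary X Y → 16 * β 𝒢 ≤ 2 ^ n
partition-bound (suc (suc (suc n))) _ 𝒢 {X} intersecting union Y≡∁X
  with bool-pigeonhole (lookup X 0F) (lookup X 1F) (lookup X 2F)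
... | inj₁ X₀≡X₁        = same-part-bound 𝒢 intersecting union Y≡∁X {0F} {1F} (λ ()) X₀≡X₁
... | inj₂ (inj₁ X₀≡X₂) = same-part-bound 𝒢 intersecting union Y≡∁X {0F} {2F} (λ ()) X₀≡X₂
... | inj₂ (inj₂ X₁≡X₂) = same-part-bound 𝒢 intersecting union Y≡∁X {1F} {2F} (λ ()) X₁≡X₂
partition-bound (suc (suc zero)) _ 𝒢 {X} intersecting union Y≡∁X
  with lookup X 0F in X₀ | lookup X 1F in X₁
... | true  | true  = same-part-bound 𝒢 intersecting union Y≡∁X {0F} {1F} (λ ()) (trans X₀ (sym X₁))
... | false | false = same-part-bound 𝒢 intersecting union Y≡∁X {0F} {1F} (λ ()) (trans X₀ (sym X₁))
... | true  | false =
  subst (λ m → 16 * m ≤ 4) (sym (singleton-part⇒β≡0 𝒢 intersecting {y = 1F} X⊆⁅0⁆ λ ())) z≤n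
  where
  X⊆⁅0⁆ : ∀ k → lookup X k ≡ true → k ≡ 0F
  X⊆⁅0⁆ 0F _   = refl
  X⊆⁅0⁆ 1F 1∈X = contradiction (trans (sym 1∈X) X₁) λ ()
... | false | true  =
  subst (λ m → 16 * m ≤ 4) (sym (singleton-part⇒β≡0 𝒢 intersecting {y = 0F} X⊆⁅1⁆ λ ())) z≤n
  where
  X⊆⁅1⁆ : ∀ k → lookup X k ≡ true → k ≡ 1F
  X⊆⁅1⁆ 0F 0∈X = contradiction (trans (sym 0∈X) X₀) λ ()
  X⊆⁅1⁆ 1F _   = refl
partition-bound 0             ()
partition-bound 1             (s≤s ())

fact6p4 : (n : ℕ) → 2 ≤ n → (𝒢 : Family n) → IU 𝒢 →
    Σ (Subset n) (λ X → Σ (Subset n) (λ Y →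
      (X ∩ Y ≡ ⊥) × (X ∪ Y ≡ ⊤) × Intersecting (Restrict 𝒢 X) × UnionOn Y (Restrict 𝒢 Y))) →
    16 * β 𝒢 ≤ 2 ^ n
fact6p4 n 2≤n 𝒢 _ (X , Y , X∩Y≡⊥ , X∪Y≡⊤ , intersecting , union) =
  partition-bound n 2≤n 𝒢 intersecting union (partition⇒complementary X∩Y≡⊥ X∪Y≡⊤)
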